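{- Let $R\subseteq\{0,1\}^k$ be any logical relation of arity $k\ge1$. Then $R$ is faithfully expressible from $\mathcal{S}_3$.
   Context: A logical relation is a non-empty subset $R\subseteq\{0,1\}^k$. For a finite set $\mathcal{S}$ of logical relations, a CNF$(\mathcal{S})$-formula is a finite conjunction of clauses $R(\xi_1,\dots,\xi_k)$ with $R\in\mathcal{S}$ of arity $k$ and each $\xi_j$ a variable or a constant $0$ or $1$. $G(\varphi)$ is the subgraph of the hypercube induced by the solutions of $\varphi$ (adjacent iff differing in exactly one variable). For $k\ge2$ and $0\le i\le k$, $D_i\subseteq\{0,1\}^k$ is the set of satisfying assignments of the $k$-clause whose first $i$ literals are negated and remaining literals positive; $\mathcal{S}_k=\{D_0,\dots,D_k\}$ (so CNF$(\mathcal{S}_3)$-formulas are 3-CNF formulas). A relation $R$ is faithfully expressible from $\mathcal{S}$ if there is a CNF$(\mathcal{S})$-formula $\varphi(\mathbf{x},\mathbf{y})$ such that: (1) $R=\{\mathbf{a}:\exists\mathbf{y}\,\varphi(\mathbf{a},\mathbf{y})\}$; (2) for every $\mathbf{a}\in R$ the graph $G(\varphi(\mathbf{a},\mathbf{y}))$ of solutions in $\mathbf{y}$ is connected; (3) for all $\mathbf{a},\mathbf{b}\in R$ at Hamming distance $1$ there is $\mathbf{w}$ with both $(\mathbf{a},\mathbf{w})$ and $(\mathbf{b},\mathbf{w})$ solutions of $\varphi$. -}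

module Defs where

open import Data.Nat using (ℕ; zero; suc; _<ᵇ_)
open import Data.Bool using (Bool; true; false; not; _∨_; _∧_; if_then_else_)
open import Data.Fin using (Fin; toℕ)
open import Data.Vec using (Vec; []; _∷_; lookup; map; _[_]%=_; foldr)
open import Data.List as L using (List; upTo; length)
open import Data.List.Relation.Unary.All using (All)
open import Data.Product using (Σ; ∃; ∃-syntax; _×_; _,_; proj₁; proj₂)
open import Relation.Binary.PropositionalEquality using (_≡_)
open import Function.Bundles using (_⇔_)

Rel : ℕ → Set
Rel k = Vec Bool k → Bool

_∈R_ : ∀ {k} → Vec Bool k → Rel k → Set
a ∈R R = R a ≡ true

-- A logical relation: a non-empty relation.
NonEmpty : ∀ {k} → Rel k → Set
NonEmpty {k} R = ∃[ a ] (a ∈R R)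

RelSet : Set
RelSet = List (Σ ℕ Rel)

D : (k i : ℕ) → Rel k
D k i v = go 0 v
  where
  go : ∀ {n} → ℕ → Vec Bool n → Bool
  go j []       = false
  go j (b ∷ bs) = (if j <ᵇ i then not b else b) ∨ go (suc j) bs

S : ℕ → RelSet
S k = L.map (λ i → k , D k i) (upTo (suc k))

data Term (k m : ℕ) : Set where
  xv : Fin k → Term k m
  yv : Fin m → Term k m
  cst : Bool → Term k m

evalT : ∀ {k m} → Vec Bool k → Vec Bool m → Term k m → Bool
evalT a w (xv j) = lookup a j
evalT a w (yv j) = lookup w j
evalT a w (cst b) = b

record Clause (𝒮 : RelSet) (k m : ℕ) : Set where
  constructor clause
  field
    rel  : Fin (length 𝒮)
    args : Vec (Term k m) (proj₁ (L.lookup 𝒮 rel))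

CNF : RelSet → ℕ → ℕ → Set
CNF 𝒮 k m = List (Clause 𝒮 k m)

SatClause : ∀ {𝒮 k m} → Clause 𝒮 k m → Vec Bool k → Vec Bool m → Set
SatClause {𝒮} (clause r as) a w = proj₂ (L.lookup 𝒮 r) (map (evalT a w) as) ≡ true

Sat : ∀ {𝒮 k m} → CNF 𝒮 k m → Vec Bool k → Vec Bool m → Set
Sat φ a w = All (λ c → SatClause c a w) φ

Adjacent : ∀ {n} → Vec Bool n → Vec Bool n → Set
Adjacent u v = ∃[ i ] (v ≡ u [ i ]%= not)

data Path {n} (P : Vec Bool n → Set) : Vec Bool n → Vec Bool n → Set where
  here : ∀ {u} → Path P u u
  step : ∀ {u v w} → P v → Adjacent u v → Path P v w → Path P u w

Connected : ∀ {n} → (Vec Bool n → Set) → Set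
Connected P = ∀ u v → P u → P v → Path P u v

FaithfullyExpressible : RelSet → ∀ {k} → Rel k → Set
FaithfullyExpressible 𝒮 {k} R =
  Σ ℕ λ m → Σ (CNF 𝒮 k m) λ φ →
    (∀ a → (a ∈R R) ⇔ (∃[ w ] Sat φ a w))
    × (∀ a → a ∈R R → Connected (Sat φ a))
    × (∀ a b → a ∈R R → b ∈R R → Adjacent a b →
         ∃[ w ] (Sat φ a w × Sat φ b w))

{-# OPTIONS --safe #-}
module Submission where

-- Write R as a disjunction T₁ ∨ … ∨ Tₘ of conjunctions of literals such that every
-- point of R, and both endpoints of every edge of R, satisfy a single term; the
-- subcubes of dimension at most 1 contained in R form such a DNF. With auxiliary
-- variables y₁ … yₘ and y₀ = 1, the 3-clauses y_{i-1} → ℓ ∨ yᵢ (ℓ ∈ Tᵢ) and ¬yₘ say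
-- exactly: whenever y_{i-1} = 1 and yᵢ = 0, the term Tᵢ holds. So a solution exists
-- iff some term holds, and the pattern 1…10…0 switching at a term shared by the two
-- endpoints of an edge is a common witness. For fixed x the solutions are connected
-- by induction on m: a leading 1 can always be lowered to 0, because nothing
-- constrains what follows a 0.

open import Defs
open import Data.Nat using (ℕ; _≤_; zero; suc)
open import Data.Bool using (Bool; true; false; not; if_then_else_)
open import Data.Bool.Properties using (∨-identityʳ; ∨-zeroʳ; ¬-not)
import Data.Bool.Properties as Bool
open import Data.Fin using (Fin; zero; suc; _≟_)
open import Data.Maybe using (Maybe; nothing; just)
open import Data.Vec as V using (Vec; []; _∷_; lookup; _[_]%=_; replicate; allFin)
open import Data.Vec.Properties using (map-lookup-allFin; lookup∘updateAt; lookup∘updateAt′; tabulate∘lookup; tabulate-cong)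
open import Data.List as L using (List; []; _∷_; length; _++_; cartesianProduct)
open import Data.List.Relation.Unary.All as All using (All; []; _∷_)
import Data.List.Relation.Unary.All.Properties as All
open import Data.List.Relation.Unary.Any as Any using (Any; here; there)
import Data.List.Relation.Unary.Any.Properties as Any
open import Data.List.Membership.Propositional using (_∈_; lose)
open import Data.List.Membership.Propositional.Properties using (∈-allFin; ∈-map⁺; ∈-cartesianProduct⁺; ∈-cartesianProductWith⁺)
open import Data.Product using (∃-syntax; _×_; _,_; proj₁; proj₂; uncurry)
open import Data.Sum using (_⊎_; inj₁; inj₂)
open import Data.Unit using (⊤; tt)
open import Function using (_∘_; id; case_of_)
open import Function.Bundles using (_⇔_; mk⇔; Equivalence)
open import Function.Properties.Equivalence using () renaming (refl to ⇔-refl)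
open import Relation.Nullary using (yes; no; does; contradiction)
open import Relation.Unary using (_⊆_)
open import Relation.Binary.PropositionalEquality using (_≡_; _≢_; refl; sym; trans; cong; subst)

open Equivalence using (to; from)

path-++ : ∀ {n} {P : Vec Bool n → Set} {u v w} → Path P u v → Path P v w → Path P u w
path-++ here           q = q
path-++ (step Pv uv p) q = step Pv uv (path-++ p q)

path-map : ∀ {n} {P Q : Vec Bool n → Set} → P ⊆ Q → ∀ {u v} → Path P u v → Path Q u v
path-map P⊆Q here           = here
path-map P⊆Q (step Pv uv p) = step (P⊆Q Pv) uv (path-map P⊆Q p)

path-∷ : ∀ {n} {P : Vec Bool (suc n) → Set} {Q : Vec Bool n → Set} {y} →
         (∀ {w} → Q w → P (y ∷ w)) → ∀ {u v} → Path Q u v → Path P (y ∷ u) (y ∷ v)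
path-∷ f here                = here
path-∷ f (step Qv (i , v≡) p) = step (f Qv) (suc i , cong (_ ∷_) v≡) (path-∷ f p)

lookup-ext : ∀ {A : Set} {n} {u v : Vec A n} → (∀ j → lookup u j ≡ lookup v j) → u ≡ v
lookup-ext {u = u} {v} u≗v =
  trans (sym (tabulate∘lookup u)) (trans (tabulate-cong u≗v) (tabulate∘lookup v))

lookup-ext-off : ∀ {A : Set} {n} {u v : Vec A n} (i : Fin n) → lookup u i ≡ lookup v i →
                 (∀ j → j ≢ i → lookup u j ≡ lookup v j) → u ≡ v
lookup-ext-off i at-i off-i = lookup-ext λ j → case j ≟ i of λ where
  (yes refl) → at-i
  (no j≢i)   → off-i j j≢i

agree-off⇒≡⊎flip : ∀ {n} (i : Fin n) {a r : Vec Bool n} →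
                   (∀ j → j ≢ i → lookup a j ≡ lookup r j) → a ≡ r ⊎ a ≡ r [ i ]%= not
agree-off⇒≡⊎flip i {a} {r} off-i with lookup a i Bool.≟ lookup r i
... | yes same = inj₁ (lookup-ext-off i same off-i)
... | no differ = inj₂ (lookup-ext-off i
  (trans (¬-not differ) (sym (lookup∘updateAt i r)))
  (λ j j≢i → trans (off-i j j≢i) (sym (lookup∘updateAt′ j i j≢i r))))

allVecs : ∀ n → List (Vec Bool n)
allVecs zero    = [] ∷ []
allVecs (suc n) = L.cartesianProductWith V._∷_ (true ∷ false ∷ []) (allVecs n)

∈-allVecs : ∀ {n} (v : Vec Bool n) → v ∈ allVecs n
∈-allVecs []               = here refl
∈-allVecs {suc n} (b ∷ v) = ∈-cartesianProductWith⁺ (V._∷_ {n = n}) (∈-bools b) (∈-allVecs v)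
  where
  ∈-bools : ∀ b → b ∈ true ∷ false ∷ []
  ∈-bools true  = here refl
  ∈-bools false = there (here refl)

infix 5 _≐_
data Literal (k : ℕ) : Set where
  _≐_   : Fin k → Bool → Literal k
  const : Bool → Literal k

⟦_⟧ : ∀ {k} → Literal k → Vec Bool k → Bool
⟦ j ≐ b ⟧ a   = if b then lookup a j else not (lookup a j)
⟦ const b ⟧ a = b

Conj : ℕ → Set
Conj k = List (Literal k)

infix 4 _⊨_
_⊨_ : ∀ {k} → Vec Bool k → Conj k → Set
a ⊨ T = All (λ l → ⟦ l ⟧ a ≡ true) T

≐-true : ∀ {k} (j : Fin k) b a → ⟦ j ≐ b ⟧ a ≡ true ⇔ lookup a j ≡ b
≐-true j true  a = ⇔-refl
≐-true j false a with lookup a j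
... | true  = mk⇔ (λ ()) (λ ())
... | false = mk⇔ (λ _ → refl) (λ _ → refl)

onesBefore : ∀ {A : Set} {P : A → Set} {xs : List A} → Any P xs → Vec Bool (length xs)
onesBefore {xs = _ ∷ xs} (here _) = false ∷ replicate (length xs) false
onesBefore (there p)               = true ∷ onesBefore p

module _ {k : ℕ} (a : Vec Bool k) where

  Step : Bool → Conj k → Bool → Set
  Step true T false = a ⊨ T
  Step _    _ _     = ⊤

  Chain : Bool → (Ts : List (Conj k)) → Vec Bool (length Ts) → Set
  Chain t []       []      = t ≡ false
  Chain t (T ∷ Ts) (y ∷ w) = Step t T y × Chain y Ts w

  Chain-true⇒false : ∀ Ts {w} → Chain true Ts w → Chain false Ts w
  Chain-true⇒false []       {[]}    ()
  Chain-true⇒false (T ∷ Ts) {_ ∷ _} (_ , c) = tt , c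

  Chain-sound : ∀ Ts w → Chain true Ts w → Any (a ⊨_) Ts
  Chain-sound []       []          ()
  Chain-sound (T ∷ Ts) (false ∷ w) (a⊨T , _) = here a⊨T
  Chain-sound (T ∷ Ts) (true ∷ w)  (_ , c)   = there (Chain-sound Ts w c)

  Chain-zeros : ∀ Ts → Chain false Ts (replicate (length Ts) false)
  Chain-zeros []       = refl
  Chain-zeros (T ∷ Ts) = tt , Chain-zeros Ts

  Chain-onesBefore : ∀ {P : Conj k → Set} {Ts} → P ⊆ (a ⊨_) → (p : Any P Ts) → Chain true Ts (onesBefore p)
  Chain-onesBefore {Ts = _ ∷ Ts} P⊆ (here PT) = P⊆ PT , Chain-zeros Ts
  Chain-onesBefore P⊆ (there p)               = tt , Chain-onesBefore P⊆ p

  Chain-connected : ∀ t Ts → Connected (Chain t Ts)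
  Chain-connected t []       []          []          _        _        = here
  Chain-connected t (T ∷ Ts) (true ∷ u)  (true ∷ v)  (s , cu) (_ , cv) =
    path-∷ (s ,_) (Chain-connected true Ts u v cu cv)
  Chain-connected t (T ∷ Ts) (false ∷ u) (false ∷ v) (s , cu) (_ , cv) =
    path-∷ (s ,_) (Chain-connected false Ts u v cu cv)
  Chain-connected t (T ∷ Ts) (true ∷ u)  (false ∷ v) (_ , cu) (s , cv) =
    step (s , cu′) (zero , refl) (path-∷ (s ,_) (Chain-connected false Ts u v cu′ cv))
    where cu′ = Chain-true⇒false Ts cu
  Chain-connected t (T ∷ Ts) (false ∷ u) (true ∷ v)  (s , cu) (s′ , cv) =
    path-++ (path-∷ (s ,_) (Chain-connected false Ts u v cu (Chain-true⇒false Ts cv)))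
            (step (s′ , cv) (zero , refl) here)

-- The clause ¬t ∨ ℓ ∨ u: relation 1 of S 3 is D₁ and relation 2 is D₂.
link : ∀ {k m} → Term k m → Literal k → Term k m → Clause (S 3) k m
link t (j ≐ true)  u = clause (suc zero) (t ∷ xv j ∷ u ∷ [])
link t (j ≐ false) u = clause (suc (suc zero)) (t ∷ xv j ∷ u ∷ [])
link t (const b)   u = clause (suc zero) (t ∷ cst b ∷ u ∷ [])

chainCNF : ∀ {k m} (Ts : List (Conj k)) → Term k m → Vec (Fin m) (length Ts) → CNF (S 3) k m
chainCNF []       t []       = link t (const false) (cst false) ∷ []
chainCNF (T ∷ Ts) t (y ∷ ys) = L.map (λ l → link t l (yv y)) T ++ chainCNF Ts (yv y) ys

D₁⇔Step : ∀ {k} (a : Vec Bool k) t T y →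
          All (λ l → D 3 1 (t ∷ ⟦ l ⟧ a ∷ y ∷ []) ≡ true) T ⇔ Step a t T y
D₁⇔Step a false T y     = mk⇔ (λ _ → tt) (λ _ → All.universal (λ _ → refl) T)
D₁⇔Step a true  T true  = mk⇔ (λ _ → tt) (λ _ → All.universal (λ l → ∨-zeroʳ (⟦ l ⟧ a)) T)
D₁⇔Step a true  T false = mk⇔ (All.map (trans (sym (∨-identityʳ _))))
                               (All.map (trans (∨-identityʳ _)))

D₁-end : ∀ t → D 3 1 (t ∷ false ∷ false ∷ []) ≡ true ⇔ t ≡ false
D₁-end true  = mk⇔ (λ ()) (λ ())
D₁-end false = mk⇔ (λ _ → refl) (λ _ → refl)

module _ {k m : ℕ} (a : Vec Bool k) (w : Vec Bool m) where

  link-sat : ∀ t l u →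
             SatClause (link t l u) a w ⇔ D 3 1 (evalT a w t ∷ ⟦ l ⟧ a ∷ evalT a w u ∷ []) ≡ true
  link-sat t (j ≐ true)  u = ⇔-refl
  link-sat t (j ≐ false) u = ⇔-refl
  link-sat t (const b)   u = ⇔-refl

  sat⇔Chain : ∀ Ts t ys → Sat (chainCNF Ts t ys) a w ⇔ Chain a (evalT a w t) Ts (V.map (lookup w) ys)
  sat⇔Chain [] t [] = mk⇔ (λ { (s ∷ []) → to (D₁-end _) s }) (λ t≡false → from (D₁-end _) t≡false ∷ [])
  sat⇔Chain (T ∷ Ts) t (y ∷ ys) = mk⇔
    (λ s → let sT , sTs = All.++⁻ links s in to links⇔Step (All.map⁻ sT) , to rest sTs)
    (λ (st , c) → All.++⁺ (All.map⁺ (from links⇔Step st)) (from rest c))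
    where
    links : CNF (S 3) k m
    links = L.map (λ l → link t l (yv y)) T

    rest : Sat (chainCNF Ts (yv y) ys) a w ⇔ Chain a (lookup w y) Ts (V.map (lookup w) ys)
    rest = sat⇔Chain Ts (yv y) ys

    links⇔Step : All (λ l → SatClause (link t l (yv y)) a w) T ⇔ Step a (evalT a w t) T (lookup w y)
    links⇔Step = mk⇔ (λ s → to (D₁⇔Step a _ T _) (All.map (λ {l} → to (link-sat t l (yv y))) s))
                     (λ st → All.map (λ {l} → from (link-sat t l (yv y))) (from (D₁⇔Step a _ T _) st))

record EdgeCoveringDNF {k} (R : Rel k) : Set where
  field
    terms        : List (Conj k)
    sound        : ∀ a → Any (a ⊨_) terms → a ∈R R
    covers-point : ∀ a → a ∈R R → Any (a ⊨_) terms
    covers-edge  : ∀ a b → a ∈R R → b ∈R R → Adjacent a b → Any (λ T → a ⊨ T × b ⊨ T) terms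

faithful-fromDNF : ∀ {k} {R : Rel k} → EdgeCoveringDNF R → FaithfullyExpressible (S 3) R
faithful-fromDNF {k} {R} dnf = m , φ , solvable , connected , shared
  where
  open EdgeCoveringDNF dnf

  m : ℕ
  m = length terms

  φ : CNF (S 3) k m
  φ = chainCNF terms (cst true) (allFin m)

  sat⇔ : ∀ a w → Sat φ a w ⇔ Chain a true terms w
  sat⇔ a w = subst (λ v → Sat φ a w ⇔ Chain a true terms v) (map-lookup-allFin w)
                   (sat⇔Chain a w terms (cst true) (allFin m))

  solvable : ∀ a → (a ∈R R) ⇔ (∃[ w ] Sat φ a w)
  solvable a = mk⇔
    (λ Ra → let p = covers-point a Ra in onesBefore p , from (sat⇔ a _) (Chain-onesBefore a id p))
    (λ (w , s) → sound a (Chain-sound a terms w (to (sat⇔ a w) s)))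

  connected : ∀ a → a ∈R R → Connected (Sat φ a)
  connected a _ u v su sv = path-map (λ {w} → from (sat⇔ a w))
    (Chain-connected a true terms u v (to (sat⇔ a u) su) (to (sat⇔ a v) sv))

  shared : ∀ a b → a ∈R R → b ∈R R → Adjacent a b → ∃[ w ] (Sat φ a w × Sat φ b w)
  shared a b Ra Rb ab = onesBefore p ,
    from (sat⇔ a _) (Chain-onesBefore a proj₁ p) , from (sat⇔ b _) (Chain-onesBefore b proj₂ p)
    where p = covers-edge a b Ra Rb ab

otherEnd : ∀ {k} → Vec Bool k → Maybe (Fin k) → Vec Bool k
otherEnd r nothing  = r
otherEnd r (just i) = r [ i ]%= not

fixed : ∀ {k} → Vec Bool k → Maybe (Fin k) → Fin k → Literal k
fixed r nothing  j = j ≐ lookup r j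
fixed r (just i) j = if does (j ≟ i) then const true else j ≐ lookup r j

-- The subcube spanned by r and otherEnd r o, killed by a false constant unless both lie in R.
cube : ∀ {k} → Rel k → Vec Bool k → Maybe (Fin k) → Conj k
cube R r o = const (R r) ∷ const (R (otherEnd r o)) ∷ L.tabulate (fixed r o)

fixed-endpoints : ∀ {k} (r : Vec Bool k) o j →
                  ⟦ fixed r o j ⟧ r ≡ true × ⟦ fixed r o j ⟧ (otherEnd r o) ≡ true
fixed-endpoints r nothing j = r⊨ , r⊨
  where r⊨ = from (≐-true j _ r) refl
fixed-endpoints r (just i) j with j ≟ i
... | yes _   = refl , refl
... | no j≢i = from (≐-true j _ r) refl , from (≐-true j _ (r [ i ]%= not)) (lookup∘updateAt′ j i j≢i r)

fixed-sound : ∀ {k} {a r : Vec Bool k} o → (∀ j → ⟦ fixed r o j ⟧ a ≡ true) → a ≡ r ⊎ a ≡ otherEnd r o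
fixed-sound {a = a} nothing a⊨ = inj₁ (lookup-ext λ j → to (≐-true j _ a) (a⊨ j))
fixed-sound {a = a} {r} (just i) a⊨ = agree-off⇒≡⊎flip i off-i
  where
  off-i : ∀ j → j ≢ i → lookup a j ≡ lookup r j
  off-i j j≢i with j ≟ i | a⊨ j
  ... | yes j≡i | _   = contradiction j≡i j≢i
  ... | no _    | a⊨j = to (≐-true j _ a) a⊨j

cube-endpoints : ∀ {k} (R : Rel k) r o → r ∈R R → otherEnd r o ∈R R →
                 r ⊨ cube R r o × otherEnd r o ⊨ cube R r o
cube-endpoints R r o Rr Rs =
  Rr ∷ Rs ∷ All.tabulate⁺ (proj₁ ∘ fixed-endpoints r o) ,
  Rr ∷ Rs ∷ All.tabulate⁺ (proj₂ ∘ fixed-endpoints r o)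

cube-sound : ∀ {k} (R : Rel k) {a} r o → a ⊨ cube R r o → a ∈R R
cube-sound R r o (Rr ∷ Rs ∷ a⊨) with fixed-sound o (All.tabulate⁻ a⊨)
... | inj₁ refl = Rr
... | inj₂ refl = Rs

options : ∀ k → List (Maybe (Fin k))
options k = nothing ∷ L.map just (L.allFin k)

∈-options : ∀ {k} (o : Maybe (Fin k)) → o ∈ options k
∈-options nothing  = here refl
∈-options (just i) = there (∈-map⁺ just (∈-allFin i))

cubesDNF : ∀ {k} (R : Rel k) → EdgeCoveringDNF R
cubesDNF {k} R = record
  { terms        = cubes
  ; sound        = λ a p → let (r , o) , a⊨ = Any.satisfied (Any.map⁻ p) in cube-sound R r o a⊨
  ; covers-point = λ a Ra → lose (∈-cubes a nothing) (proj₁ (cube-endpoints R a nothing Ra Ra))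
  ; covers-edge  = λ { a _ Ra Rb (i , refl) → lose (∈-cubes a (just i)) (cube-endpoints R a (just i) Ra Rb) }
  }
  where
  cubes : List (Conj k)
  cubes = L.map (uncurry (cube R)) (cartesianProduct (allVecs k) (options k))

  ∈-cubes : ∀ r o → cube R r o ∈ cubes
  ∈-cubes r o = ∈-map⁺ (uncurry (cube R)) (∈-cartesianProduct⁺ (∈-allVecs r) (∈-options o))

lemma3p5 : (k : ℕ) → 1 ≤ k → (R : Rel k) → NonEmpty R →
    FaithfullyExpressible (S 3) R
lemma3p5 k _ R _ = faithful-fromDNF (cubesDNF R)
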